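{- Let $q$ be a prime power, let $2\le m \le k$ be integers and let $L$ be an $(m \times k)$-system over $\mathbb{F}_q$. Let $B \in \mathcal{C}(L)$. Then: (i) the $(m_B\times c(L))$-system induced by $L$ on $B$ is unique up to equivalence; (ii) if $s(L)$ is even, then $m_B = 1$; (iii) if $s(L)$ is odd, then $m_B\in\{1,2\}$.
   Context: A system of $m$ linear forms in $k$ variables over $\mathbb{F}_q$ is identified with its $m\times k$ coefficient matrix; it is an $(m\times k)$-system if the rows are linearly independent over $\mathbb{F}_q$. For $B=\{i_1<\dots<i_\ell\}\subseteq[k]$ and an $\ell$-variable system $L'$, $L$ induces $L'$ on $B$ if for every $\mathbf{x}\in\mathbb{F}_q^k$, $L(x_1,\dots,x_k)=0$ implies $L'(x_{i_1},\dots,x_{i_\ell})=0$. Two systems in the same variables are equivalent if each induces the other (equivalently, one matrix is obtained from the other by elementary row operations). The length of an equation is its number of nonzero coefficients; $s(L)$ is the minimal length of a (nontrivial) equation induced by $L$. Set $c(L)=s(L)$ if $s(L)$ is even and $c(L)=s(L)+1$ if $s(L)$ is odd. A set $B\subseteq[k]$ is critical for $L$ if $|B|=c(L)$ and some (nontrivial) system is induced by $L$ on $B$; $\mathcal{C}(L)$ is the family of critical sets. For $B\in\mathcal{C}(L)$ with $|B|=b$, $m_B$ is the maximal $m'$ such that there is an $(m'\times b)$-system induced by $L$ on $B$. -}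

module Defs where

open import Level using (Level; _⊔_) renaming (suc to lsuc)
open import Data.Nat using (ℕ; _≤_; parity)
open import Data.Parity.Base using (Parity; 0ℙ; 1ℙ)
open import Relation.Binary.PropositionalEquality using (_≡_)
open import Data.Fin using (Fin; _<_)
open import Data.Fin.Subset using (Subset; ∣_∣)
open import Data.Vec using (tabulate)
open import Data.Bool using (Bool; true; false)
open import Data.Product using (Σ; ∃; _×_; _,_)
open import Relation.Nullary using (¬_; Dec; yes; no)
open import Relation.Binary using (Decidable)
open import Algebra.Bundles using (CommutativeRing)
import Algebra.Definitions.RawMonoid as RawMonoidDefs

-- Every finite field is 𝔽_q for a
-- prime power q = size, and conversely.
record FiniteField (c ℓ : Level) : Set (lsuc (c ⊔ ℓ)) where
  field
    commRing  : CommutativeRing c ℓ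
  open CommutativeRing commRing public
  field
    0≉1       : ¬ (0# ≈ 1#)
    inverse   : ∀ x → ¬ (x ≈ 0#) → Σ Carrier (λ y → (x * y) ≈ 1#)
    _≟_       : Decidable _≈_
    size      : ℕ
    enum      : Fin size → Carrier
    enum-onto : ∀ x → Σ (Fin size) (λ i → enum i ≈ x)

module LinearForms {c ℓ : Level} (F : FiniteField c ℓ) where
  open FiniteField F
  open RawMonoidDefs +-rawMonoid using (sum)

  System : ℕ → ℕ → Set c
  System m k = Fin m → Fin k → Carrier

  dot : ∀ {k} → (Fin k → Carrier) → (Fin k → Carrier) → Carrier
  dot a x = sum (λ j → a j * x j)

  Solves : ∀ {m k} → System m k → (Fin k → Carrier) → Set ℓ
  Solves L x = ∀ i → dot (L i) x ≈ 0#

  RowsIndependent : ∀ {m k} → System m k → Set (c ⊔ ℓ)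
  RowsIndependent {m} {k} L =
    ∀ (λ' : Fin m → Carrier) →
      (∀ j → sum (λ i → λ' i * L i j) ≈ 0#) → ∀ i → λ' i ≈ 0#

  IsSystem : ∀ {m k} → System m k → Set (c ⊔ ℓ)
  IsSystem = RowsIndependent

  -- a subset B = {i₁ < … < i_b} of [k], given by its strictly increasing
  -- enumeration ι : Fin b → Fin k
  StrictlyIncreasing : ∀ {b k} → (Fin b → Fin k) → Set
  StrictlyIncreasing ι = ∀ {j j'} → j < j' → ι j < ι j'

  Induces : ∀ {m k m' b} → System m k → (Fin b → Fin k) → System m' b → Set (c ⊔ ℓ)
  Induces L ι L' = ∀ x → Solves L x → Solves L' (λ j → x (ι j))

  Equivalent : ∀ {m m' k} → System m k → System m' k → Set (c ⊔ ℓ)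
  Equivalent L L' = Induces L (λ j → j) L' × Induces L' (λ j → j) L

  Nontrivial : ∀ {m k} → System m k → Set ℓ
  Nontrivial {m} {k} L = Σ (Fin m) (λ i → Σ (Fin k) (λ j → ¬ (L i j ≈ 0#)))

  Equation : ℕ → Set c
  Equation k = Fin k → Carrier

  asSystem : ∀ {k} → Equation k → System 1 k
  asSystem a _ = a

  NontrivialEq : ∀ {k} → Equation k → Set ℓ
  NontrivialEq {k} a = Σ (Fin k) (λ j → ¬ (a j ≈ 0#))

  support : ∀ {k} → Equation k → Subset k
  support a = tabulate (λ j → supp (a j ≟ 0#))
    where
    supp : ∀ {P : Set ℓ} → Dec P → Bool
    supp (yes _) = false
    supp (no _)  = true

  eqLength : ∀ {k} → Equation k → ℕ
  eqLength a = ∣ support a ∣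

  IsS : ∀ {m k} → System m k → ℕ → Set (c ⊔ ℓ)
  IsS {m} {k} L s =
    Σ (Equation k) (λ a → NontrivialEq a × Induces L (λ j → j) (asSystem a)
                           × eqLength a ≡ s)
    × (∀ (a : Equation k) → NontrivialEq a → Induces L (λ j → j) (asSystem a) → s ≤ eqLength a)

  cOf : ℕ → ℕ
  cOf s with parity s
  ... | 0ℙ = s
  ... | 1ℙ = Data.Nat.suc s

  IsCritical : ∀ {m k b} → System m k → ℕ → (Fin b → Fin k) → Set (c ⊔ ℓ)
  IsCritical {m} {k} {b} L s ι =
    StrictlyIncreasing ι × b ≡ cOf s
    × Σ ℕ (λ m' → Σ (System m' b) (λ L' → Nontrivial L' × Induces L ι L'))

  IsMB : ∀ {m k b} → System m k → (Fin b → Fin k) → ℕ → Set (c ⊔ ℓ)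
  IsMB {m} {k} {b} L ι mB =
    Σ (System mB b) (λ L' → IsSystem L' × Induces L ι L')
    × (∀ (m' : ℕ) (L' : System m' b) → IsSystem L' → Induces L ι L' → m' ≤ mB)

-- An (r × b)-system induced by L on B with r ≥ 1 has a nonzero combination of
-- its rows vanishing on any r − 1 chosen coordinates of B (r unknowns, r − 1
-- homogeneous equations).  That combination is a nontrivial equation induced
-- by L supported on the remaining b − r + 1 variables, so s(L) ≤ b − r + 1.
-- For b = c(L) this gives m_B ≤ 1 when s(L) is even and m_B ≤ 2 when s(L) is
-- odd, while m_B ≥ 1 because B is critical.  Uniqueness is maximality: an
-- equation induced on B but not implied by a maximal induced system could be
-- added to it, keeping the rows independent.
module Submission where

open import Defs
open import Level using (Level)
import Data.Nat as ℕ
open import Data.Nat using (ℕ; zero; suc; _≤_; _<_; parity; s≤s)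
import Data.Nat.Properties as ℕₚ
open import Data.Parity.Base using (0ℙ; 1ℙ)
open import Data.Fin using (Fin; zero; suc; _↑ˡ_; _↑ʳ_; splitAt; punchIn; punchOut)
import Data.Fin.Properties as Fin
open import Data.Fin.Subset using (Subset; ⊥; inside; outside; _∈_; _⊆_; _∪_; ⁅_⁆; ∣_∣)
open import Data.Fin.Subset.Properties
  using (∣⊥∣≡0; ∣p∣≤∣x∷p∣; x∈⁅x⁆; x∈p∪q⁺; ∪-identityˡ; p⊆q⇒∣p∣≤∣q∣)
open import Data.Vec using (_∷_)
open import Data.Vec.Properties using ([]=⇒lookup; lookup∘tabulate)
import Data.Vec.Functional as Vector
open import Data.Product using (∃; _×_; _,_)
open import Data.Sum as Sum using (_⊎_; inj₁; inj₂)
open import Data.Empty using (⊥-elim)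
open import Function using (id; _∘_)
open import Function.Definitions using (Injective)
open import Relation.Nullary using (¬_; Dec; yes; no)
open import Relation.Nullary.Decidable using (¬?; _×-dec_; decidable-stable)
open import Relation.Binary using (tri<; tri≈; tri>)
open import Relation.Binary.PropositionalEquality as ≡ using (_≡_)
import Algebra.Definitions.RawMonoid as RawMonoidDefs
import Algebra.Solver.Ring.NaturalCoefficients.Default as NaturalSolver

image : ∀ {u n} → (Fin u → Fin n) → Subset n
image {zero}  f = ⊥
image {suc u} f = ⁅ f zero ⁆ ∪ image (f ∘ suc)

f[j]∈image : ∀ {u n} (f : Fin u → Fin n) j → f j ∈ image f
f[j]∈image f zero    = x∈p∪q⁺ (inj₁ (x∈⁅x⁆ (f zero)))
f[j]∈image f (suc j) = x∈p∪q⁺ (inj₂ (f[j]∈image (f ∘ suc) j))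

∣⁅x⁆∪p∣≤1+∣p∣ : ∀ {n} (x : Fin n) p → ∣ ⁅ x ⁆ ∪ p ∣ ≤ suc ∣ p ∣
∣⁅x⁆∪p∣≤1+∣p∣ zero    (s ∷ p)       rewrite ∪-identityˡ p = s≤s (∣p∣≤∣x∷p∣ s p)
∣⁅x⁆∪p∣≤1+∣p∣ (suc x) (outside ∷ p) = ∣⁅x⁆∪p∣≤1+∣p∣ x p
∣⁅x⁆∪p∣≤1+∣p∣ (suc x) (inside ∷ p)  = s≤s (∣⁅x⁆∪p∣≤1+∣p∣ x p)

∣image∣≤ : ∀ {u n} (f : Fin u → Fin n) → ∣ image f ∣ ≤ u
∣image∣≤ {zero} {n} f = ℕₚ.≤-reflexive (∣⊥∣≡0 n)
∣image∣≤ {suc u}    f =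
  ℕₚ.≤-trans (∣⁅x⁆∪p∣≤1+∣p∣ (f zero) (image (f ∘ suc))) (s≤s (∣image∣≤ (f ∘ suc)))

module _ {c ℓ : Level} (F : FiniteField c ℓ) where
  open FiniteField F hiding (zero)
  open LinearForms F
  open RawMonoidDefs +-rawMonoid using (sum)
  open import Algebra.Properties.Semiring.Sum semiring
    using (sum-cong-≋; sum-replicate-zero; ∑-comm; ∑-distrib-+; *-distribˡ-sum; *-distribʳ-sum)
  open import Algebra.Properties.Ring ring using (-‿distribˡ-*; -‿distribʳ-*)
  open import Relation.Binary.Reasoning.Setoid setoid
  open NaturalSolver commutativeSemiring using (solve; _:=_; _:+_; _:*_)

  1≉0 : ¬ (1# ≈ 0#)
  1≉0 1≈0 = 0≉1 (sym 1≈0)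

  *-cancelˡ-≈0 : ∀ {x y} → ¬ (x ≈ 0#) → x * y ≈ 0# → y ≈ 0#
  *-cancelˡ-≈0 {x} {y} x≉0 xy≈0 with inverse x x≉0
  ... | x⁻¹ , xx⁻¹≈1 = begin
    y              ≈⟨ sym (*-identityˡ y) ⟩
    1# * y         ≈⟨ *-congʳ (sym xx⁻¹≈1) ⟩
    (x * x⁻¹) * y  ≈⟨ *-congʳ (*-comm x x⁻¹) ⟩
    (x⁻¹ * x) * y  ≈⟨ *-assoc x⁻¹ x y ⟩
    x⁻¹ * (x * y)  ≈⟨ *-congˡ xy≈0 ⟩
    x⁻¹ * 0#       ≈⟨ zeroʳ x⁻¹ ⟩
    0#             ∎

  *-cancelʳ-≈0 : ∀ {x y} → ¬ (y ≈ 0#) → x * y ≈ 0# → x ≈ 0#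
  *-cancelʳ-≈0 {x} {y} y≉0 xy≈0 = *-cancelˡ-≈0 y≉0 (trans (*-comm y x) xy≈0)

  *-≉0 : ∀ {x y} → ¬ (x ≈ 0#) → ¬ (y ≈ 0#) → ¬ (x * y ≈ 0#)
  *-≉0 x≉0 y≉0 xy≈0 = y≉0 (*-cancelˡ-≈0 x≉0 xy≈0)

  sum-≈0 : ∀ {n} {f : Fin n → Carrier} → (∀ i → f i ≈ 0#) → sum f ≈ 0#
  sum-≈0 {n} f≈0 = trans (sum-cong-≋ f≈0) (sum-replicate-zero n)

  sum-*0 : ∀ {n} (f : Fin n → Carrier) {g : Fin n → Carrier} →
           (∀ i → g i ≈ 0#) → sum (λ i → f i * g i) ≈ 0#
  sum-*0 f g≈0 = sum-≈0 (λ i → trans (*-congˡ (g≈0 i)) (zeroʳ (f i)))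

  sum-0* : ∀ {n} {f : Fin n → Carrier} (g : Fin n → Carrier) →
           (∀ i → f i ≈ 0#) → sum (λ i → f i * g i) ≈ 0#
  sum-0* g f≈0 = sum-≈0 (λ i → trans (*-congʳ (f≈0 i)) (zeroˡ (g i)))

  δ : ∀ {n} → Fin n → Fin n → Carrier
  δ zero    zero    = 1#
  δ zero    (suc _) = 0#
  δ (suc _) zero    = 0#
  δ (suc a) (suc i) = δ a i

  δ-≢ : ∀ {n} (a i : Fin n) → ¬ (a ≡ i) → δ a i ≈ 0#
  δ-≢ zero    zero    a≢i = ⊥-elim (a≢i ≡.refl)
  δ-≢ zero    (suc i) a≢i = refl
  δ-≢ (suc a) zero    a≢i = refl
  δ-≢ (suc a) (suc i) a≢i = δ-≢ a i (a≢i ∘ ≡.cong suc)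

  δ-refl : ∀ {n} (a : Fin n) → δ a a ≈ 1#
  δ-refl zero    = refl
  δ-refl (suc a) = δ-refl a

  sum-δ : ∀ {n} (a : Fin n) (f : Fin n → Carrier) → sum (λ i → δ a i * f i) ≈ f a
  sum-δ zero    f = trans (+-cong (*-identityˡ (f zero)) (sum-0* (f ∘ suc) (λ _ → refl)))
                          (+-identityʳ (f zero))
  sum-δ (suc a) f = trans (+-cong (zeroˡ (f zero)) (sum-δ a (f ∘ suc))) (+-identityˡ _)

  combination : ∀ {r b} → (Fin r → Carrier) → System r b → Equation b
  combination λ′ R j = sum (λ i → λ′ i * R i j)

  dot-combination : ∀ {r b} (λ′ : Fin r → Carrier) (R : System r b) x →
                    dot (combination λ′ R) x ≈ sum (λ i → λ′ i * dot (R i) x)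
  dot-combination λ′ R x = begin
    sum (λ j → sum (λ i → λ′ i * R i j) * x j)
      ≈⟨ sum-cong-≋ (λ j → *-distribʳ-sum (x j) (λ i → λ′ i * R i j)) ⟩
    sum (λ j → sum (λ i → (λ′ i * R i j) * x j))
      ≈⟨ ∑-comm (λ j i → (λ′ i * R i j) * x j) ⟩
    sum (λ i → sum (λ j → (λ′ i * R i j) * x j))
      ≈⟨ sum-cong-≋ (λ i → sum-cong-≋ (λ j → *-assoc (λ′ i) (R i j) (x j))) ⟩
    sum (λ i → sum (λ j → λ′ i * (R i j * x j)))
      ≈⟨ sum-cong-≋ (λ i → sym (*-distribˡ-sum (λ′ i) (λ j → R i j * x j))) ⟩
    sum (λ i → λ′ i * dot (R i) x) ∎

  nontrivial? : ∀ {k} (v : Equation k) → Dec (NontrivialEq v)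
  nontrivial? v = Fin.any? (λ j → ¬? (v j ≟ 0#))

  trivial⇒≈0 : ∀ {k} {v : Equation k} → ¬ NontrivialEq v → ∀ j → v j ≈ 0#
  trivial⇒≈0 {v = v} v-trivial j = decidable-stable (v j ≟ 0#) (λ vⱼ≉0 → v-trivial (j , vⱼ≉0))

  eliminate : ∀ {m} → Equation (suc m) → Equation (suc m) → Equation m
  eliminate a e j = a zero * e (suc j) + (- e zero) * a (suc j)

  back-substitute : ∀ {m} → Equation (suc m) → (Fin m → Carrier) → Fin (suc m) → Carrier
  back-substitute a y = (- dot (a ∘ suc) y) Vector.∷ (λ j → a zero * y j)

  dot-back-substitute : ∀ {m} (a e : Equation (suc m)) y →
                        dot e (back-substitute a y) ≈ dot (eliminate a e) y
  dot-back-substitute a e y = begin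
    e zero * (- D) + sum (λ j → e (suc j) * (a zero * y j))
      ≈⟨ +-congʳ (trans (sym (-‿distribʳ-* (e zero) D)) (-‿distribˡ-* (e zero) D)) ⟩
    (- e zero) * D + sum (λ j → e (suc j) * (a zero * y j))
      ≈⟨ +-comm _ _ ⟩
    sum (λ j → e (suc j) * (a zero * y j)) + (- e zero) * D
      ≈⟨ +-congˡ (*-distribˡ-sum (- e zero) (λ j → a (suc j) * y j)) ⟩
    sum (λ j → e (suc j) * (a zero * y j)) + sum (λ j → (- e zero) * (a (suc j) * y j))
      ≈⟨ sym (∑-distrib-+ (λ j → e (suc j) * (a zero * y j)) (λ j → (- e zero) * (a (suc j) * y j))) ⟩
    sum (λ j → e (suc j) * (a zero * y j) + (- e zero) * (a (suc j) * y j))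
      ≈⟨ sum-cong-≋ (λ j → sym (regroup (a zero) (e (suc j)) (- e zero) (a (suc j)) (y j))) ⟩
    dot (eliminate a e) y ∎
    where
    D = dot (a ∘ suc) y
    regroup : ∀ a₀ eⱼ n aⱼ yⱼ → (a₀ * eⱼ + n * aⱼ) * yⱼ ≈ eⱼ * (a₀ * yⱼ) + n * (aⱼ * yⱼ)
    regroup = solve 5 (λ a₀ eⱼ n aⱼ yⱼ →
      (a₀ :* eⱼ :+ n :* aⱼ) :* yⱼ := eⱼ :* (a₀ :* yⱼ) :+ n :* (aⱼ :* yⱼ)) refl

  eliminate-self : ∀ {m} (a : Equation (suc m)) j → eliminate a a j ≈ 0#
  eliminate-self a j =
    trans (+-congˡ (sym (-‿distribˡ-* (a zero) (a (suc j))))) (-‿inverseʳ (a zero * a (suc j)))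

  -- Gaussian elimination: pivot on a nonzero entry of the first column, or
  -- take the first unit vector if that column vanishes.
  underdetermined-solution : ∀ {n m} → n < m → (A : System n m) →
                             ∃ λ x → NontrivialEq x × Solves A x
  underdetermined-solution {_}     {zero}  ()
  underdetermined-solution {zero}  {suc m} _ A = (λ _ → 1#) , (zero , 1≉0) , λ ()
  underdetermined-solution {suc n} {suc m} (s≤s n<m) A with nontrivial? (λ i → A i zero)
  ... | no no-pivot = δ zero , (zero , 1≉0) , solves
    where
    solves : Solves A (δ zero)
    solves i = begin
      A i zero * 1# + sum (λ j → A i (suc j) * 0#)
        ≈⟨ +-cong (*-identityʳ (A i zero)) (sum-*0 (A i ∘ suc) (λ _ → refl)) ⟩
      A i zero + 0#
        ≈⟨ +-identityʳ (A i zero) ⟩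
      A i zero
        ≈⟨ trivial⇒≈0 no-pivot i ⟩
      0# ∎
  ... | yes (p , pivot) with underdetermined-solution n<m (λ i → eliminate (A p) (A (punchIn p i)))
  ...   | y , (j , yⱼ≉0) , y-solves = back-substitute (A p) y , (suc j , *-≉0 pivot yⱼ≉0) , solves
    where
    solves : Solves A (back-substitute (A p) y)
    solves q with p Fin.≟ q
    ... | yes ≡.refl = trans (dot-back-substitute (A p) (A p) y) (sum-0* y (eliminate-self (A p)))
    ... | no p≢q = trans (dot-back-substitute (A p) (A q) y)
      (≡.subst (λ q → dot (eliminate (A p) (A q)) y ≈ 0#)
               (Fin.punchIn-punchOut p≢q) (y-solves (punchOut p≢q)))

  vanishing-combination : ∀ {t r b} → t < r → (R : System r b) (κ : Fin t → Fin b) →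
                          ∃ λ λ′ → NontrivialEq λ′ × ∀ i → combination λ′ R (κ i) ≈ 0#
  vanishing-combination t<r R κ with underdetermined-solution t<r (λ i j → R j (κ i))
  ... | λ′ , λ′≢0 , λ′-solves =
    λ′ , λ′≢0 , λ i → trans (sum-cong-≋ (λ j → *-comm (λ′ j) (R j (κ i)))) (λ′-solves i)

  combination-nontrivial : ∀ {r b} (R : System r b) → IsSystem R →
                           ∀ {λ′} → NontrivialEq λ′ → NontrivialEq (combination λ′ R)
  combination-nontrivial R R-independent {λ′} (i , λ′ᵢ≉0) =
    decidable-stable (nontrivial? (combination λ′ R))
      (λ trivial → λ′ᵢ≉0 (R-independent λ′ (trivial⇒≈0 trivial) i))

  rows≤columns : ∀ {r b} (R : System r b) → IsSystem R → r ≤ b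
  rows≤columns R R-independent = ℕₚ.≮⇒≥ λ b<r →
    let λ′ , (i , λ′ᵢ≉0) , vanishes = vanishing-combination b<r R id
    in  λ′ᵢ≉0 (R-independent λ′ vanishes i)

  combination-induced : ∀ {m k r b} {L : System m k} {ι : Fin b → Fin k} (R : System r b) →
                        Induces L ι R → ∀ λ′ → Induces L ι (asSystem (combination λ′ R))
  combination-induced R R-induced λ′ x x-solves _ =
    trans (dot-combination λ′ R _) (sum-*0 λ′ (R-induced x x-solves))

  extend : ∀ {b k} → (Fin b → Fin k) → Equation b → Equation k
  extend ι v i = sum (λ j → δ (ι j) i * v j)

  dot-extend : ∀ {b k} (ι : Fin b → Fin k) (v : Equation b) x →
               dot (extend ι v) x ≈ dot v (x ∘ ι)
  dot-extend ι v x = begin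
    sum (λ i → sum (λ j → δ (ι j) i * v j) * x i)
      ≈⟨ sum-cong-≋ (λ i → *-distribʳ-sum (x i) (λ j → δ (ι j) i * v j)) ⟩
    sum (λ i → sum (λ j → (δ (ι j) i * v j) * x i))
      ≈⟨ ∑-comm (λ i j → (δ (ι j) i * v j) * x i) ⟩
    sum (λ j → sum (λ i → (δ (ι j) i * v j) * x i))
      ≈⟨ sum-cong-≋ (λ j → sum-cong-≋ (λ i → swap (δ (ι j) i) (v j) (x i))) ⟩
    sum (λ j → sum (λ i → v j * (δ (ι j) i * x i)))
      ≈⟨ sum-cong-≋ (λ j → sym (*-distribˡ-sum (v j) (λ i → δ (ι j) i * x i))) ⟩
    sum (λ j → v j * sum (λ i → δ (ι j) i * x i))
      ≈⟨ sum-cong-≋ (λ j → *-congˡ (sum-δ (ι j) x)) ⟩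
    sum (λ j → v j * x (ι j)) ∎
    where
    swap : ∀ d a y → (d * a) * y ≈ a * (d * y)
    swap = solve 3 (λ d a y → (d :* a) :* y := a :* (d :* y)) refl

  extend-induced : ∀ {m k b} {L : System m k} (ι : Fin b → Fin k) (v : Equation b) →
                   Induces L ι (asSystem v) → Induces L id (asSystem (extend ι v))
  extend-induced ι v v-induced x x-solves i =
    trans (dot-extend ι v x) (v-induced x x-solves i)

  strictlyIncreasing⇒injective : ∀ {b k} {ι : Fin b → Fin k} →
                                 StrictlyIncreasing ι → Injective _≡_ _≡_ ι
  strictlyIncreasing⇒injective increasing {j} {j'} ιj≡ιj' with Fin.<-cmp j j'
  ... | tri< j<j' _ _ = ⊥-elim (Fin.<-irrefl ιj≡ιj' (increasing j<j'))
  ... | tri≈ _ j≡j' _ = j≡j'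
  ... | tri> _ _ j'<j = ⊥-elim (Fin.<-irrefl (≡.sym ιj≡ιj') (increasing j'<j))

  extend-at : ∀ {b k} {ι : Fin b → Fin k} → Injective _≡_ _≡_ ι →
              ∀ (v : Equation b) a → extend ι v (ι a) ≈ v a
  extend-at {ι = ι} ι-injective v a = trans (sum-cong-≋ (λ j → *-congʳ (δ-image j))) (sum-δ a v)
    where
    δ-image : ∀ j → δ (ι j) (ι a) ≈ δ a j
    δ-image j with a Fin.≟ j
    ... | yes ≡.refl = trans (δ-refl (ι a)) (sym (δ-refl a))
    ... | no a≢j = trans (δ-≢ (ι j) (ι a) (a≢j ∘ ≡.sym ∘ ι-injective)) (sym (δ-≢ a j a≢j))

  extend-nontrivial : ∀ {b k} {ι : Fin b → Fin k} → Injective _≡_ _≡_ ι →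
                      ∀ {v} → NontrivialEq v → NontrivialEq (extend ι v)
  extend-nontrivial ι-injective {v} (j , vⱼ≉0) =
    _ , λ ≈0 → vⱼ≉0 (trans (sym (extend-at ι-injective v j)) ≈0)

  extend-support : ∀ {b k} (ι : Fin b → Fin k) (v : Equation b) i →
                   ¬ (extend ι v i ≈ 0#) → ∃ λ j → ι j ≡ i × ¬ (v j ≈ 0#)
  extend-support ι v i ≉0 = decidable-stable
    (Fin.any? (λ j → (ι j Fin.≟ i) ×-dec ¬? (v j ≟ 0#)))
    (λ none → ≉0 (sum-≈0 (λ j → term≈0 j (λ ιj≡i vⱼ≉0 → none (j , ιj≡i , vⱼ≉0)))))
    where
    term≈0 : ∀ j → (ι j ≡ i → ¬ ¬ (v j ≈ 0#)) → δ (ι j) i * v j ≈ 0#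
    term≈0 j vⱼ≈0 with ι j Fin.≟ i
    ... | no ιj≢i  = trans (*-congʳ (δ-≢ (ι j) i ιj≢i)) (zeroˡ (v j))
    ... | yes ιj≡i = trans (*-congˡ (decidable-stable (v j ≟ 0#) (vⱼ≈0 ιj≡i))) (zeroʳ _)

  ∈-support⇒≉0 : ∀ {k} (a : Equation k) {i} → i ∈ support a → ¬ (a i ≈ 0#)
  ∈-support⇒≉0 a {i} i∈support with ≡.trans (≡.sym (lookup∘tabulate _ i)) ([]=⇒lookup i∈support)
  ... | supp≡inside with a i ≟ 0#
  ...   | no aᵢ≉0 = aᵢ≉0
  ...   | yes _   with () ← supp≡inside

  eqLength≤ : ∀ {u k} (a : Equation k) (f : Fin u → Fin k) →
              (∀ i → ¬ (a i ≈ 0#) → ∃ λ j → f j ≡ i) → eqLength a ≤ u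
  eqLength≤ a f covers = ℕₚ.≤-trans (p⊆q⇒∣p∣≤∣q∣ support⊆image) (∣image∣≤ f)
    where
    support⊆image : support a ⊆ image f
    support⊆image i∈support with covers _ (∈-support⇒≉0 a i∈support)
    ... | j , ≡.refl = f[j]∈image f j

  eqLength-extend≤ : ∀ {u b k} (ι : Fin b → Fin k) (v : Equation b) (g : Fin u → Fin b) →
                     (∀ j → ¬ (v j ≈ 0#) → ∃ λ i → g i ≡ j) → eqLength (extend ι v) ≤ u
  eqLength-extend≤ ι v g covers = eqLength≤ (extend ι v) (ι ∘ g) λ i ≉0 →
    let j , ιj≡i , vⱼ≉0 = extend-support ι v i ≉0
        i′ , gi′≡j      = covers j vⱼ≉0
    in  i′ , ≡.trans (≡.cong ι gi′≡j) ιj≡i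

  support-in-↑ʳ : ∀ {t u} (v : Equation (t ℕ.+ u)) → (∀ i → v (i ↑ˡ u) ≈ 0#) →
                  ∀ j → ¬ (v j ≈ 0#) → ∃ λ i → t ↑ʳ i ≡ j
  support-in-↑ʳ {t} v ↑ˡ-vanishes j vⱼ≉0 with splitAt t j in split
  ... | inj₁ i = ⊥-elim (vⱼ≉0 (≡.subst (λ j → v j ≈ 0#) (Fin.splitAt⁻¹-↑ˡ split) (↑ˡ-vanishes i)))
  ... | inj₂ i = i , Fin.splitAt⁻¹-↑ʳ split

  s≤free-coordinates : ∀ {m k t u s} {L : System m k} {ι : Fin (t ℕ.+ u) → Fin k} →
                       IsS L s → Injective _≡_ _≡_ ι →
                       (R : System (suc t) (t ℕ.+ u)) → IsSystem R → Induces L ι R → s ≤ u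
  s≤free-coordinates {t = t} {u} {ι = ι} (_ , s-minimal) ι-injective R R-independent R-induced
    with vanishing-combination (ℕₚ.n<1+n t) R (_↑ˡ u)
  ... | λ′ , λ′≢0 , ↑ˡ-vanishes = ℕₚ.≤-trans
    (s-minimal (extend ι v)
      (extend-nontrivial ι-injective (combination-nontrivial R R-independent λ′≢0))
      (extend-induced ι v (combination-induced R R-induced λ′)))
    (eqLength-extend≤ ι v (t ↑ʳ_) (support-in-↑ʳ v ↑ˡ-vanishes))
    where
    v = combination λ′ R

  s+rows≤1+size : ∀ {m k r b s} {L : System m k} {ι : Fin b → Fin k} →
                  IsS L s → Injective _≡_ _≡_ ι →
                  (R : System r b) → IsSystem R → Induces L ι R → 1 ≤ r → s ℕ.+ r ≤ suc b
  s+rows≤1+size {r = suc t} {s = s} s-is-s ι-injective R R-independent R-induced _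
    with ℕₚ.m≤n⇒∃[o]m+o≡n (ℕₚ.≤-trans (ℕₚ.n≤1+n t) (rows≤columns R R-independent))
  ... | u , ≡.refl =
    ℕₚ.≤-trans (ℕₚ.+-monoˡ-≤ (suc t) (s≤free-coordinates s-is-s ι-injective R R-independent R-induced))
               (ℕₚ.≤-reflexive (ℕₚ.+-comm u (suc t)))

  ∷-independent : ∀ {r b} (e : Equation b) (S : System r b) → IsSystem S →
                  ∀ {x} → Solves S x → ¬ (dot e x ≈ 0#) → IsSystem (e Vector.∷ S)
  ∷-independent e S S-independent {x} x-solves ex≉0 λ′ combination≈0 = λ′≈0
    where
    λ′₀≈0 : λ′ zero ≈ 0#
    λ′₀≈0 = *-cancelʳ-≈0 ex≉0 (begin
      λ′ zero * dot e x                                 ≈⟨ sym (+-identityʳ _) ⟩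
      λ′ zero * dot e x + 0#                            ≈⟨ +-congˡ (sym (sum-*0 (λ′ ∘ suc) x-solves)) ⟩
      sum (λ i → λ′ i * dot ((e Vector.∷ S) i) x)       ≈⟨ sym (dot-combination λ′ (e Vector.∷ S) x) ⟩
      dot (combination λ′ (e Vector.∷ S)) x             ≈⟨ sum-0* x combination≈0 ⟩
      0#                                                ∎)
    tail-combination≈0 : ∀ j → combination (λ′ ∘ suc) S j ≈ 0#
    tail-combination≈0 j = begin
      combination (λ′ ∘ suc) S j                  ≈⟨ sym (+-identityˡ _) ⟩
      0# + combination (λ′ ∘ suc) S j             ≈⟨ +-congʳ (sym (trans (*-congʳ λ′₀≈0) (zeroˡ (e j)))) ⟩
      λ′ zero * e j + combination (λ′ ∘ suc) S j  ≈⟨ combination≈0 j ⟩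
      0#                                          ∎
    λ′≈0 : ∀ i → λ′ i ≈ 0#
    λ′≈0 zero    = λ′₀≈0
    λ′≈0 (suc i) = S-independent (λ′ ∘ suc) tail-combination≈0 i

  ∷-induced : ∀ {m k r b} {L : System m k} {ι : Fin b → Fin k} {e : Equation b} {S : System r b} →
              Induces L ι (asSystem e) → Induces L ι S → Induces L ι (e Vector.∷ S)
  ∷-induced e-induced S-induced x x-solves zero    = e-induced x x-solves zero
  ∷-induced e-induced S-induced x x-solves (suc i) = S-induced x x-solves i

  maximal-induces : ∀ {m k r b} {L : System m k} {ι : Fin b → Fin k} →
                    (∀ r′ (R′ : System r′ b) → IsSystem R′ → Induces L ι R′ → r′ ≤ r) →
                    (R : System r b) → IsSystem R → Induces L ι R →
                    ∀ {r′} (R′ : System r′ b) → Induces L ι R′ → Induces R id R′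
  maximal-induces maximal R R-independent R-induced R′ R′-induced x x-solves i
    with dot (R′ i) x ≟ 0#
  ... | yes ≈0 = ≈0
  ... | no ≉0 = ⊥-elim (ℕₚ.<-irrefl ≡.refl
    (maximal _ (R′ i Vector.∷ R) (∷-independent (R′ i) R R-independent x-solves ≉0)
      (∷-induced {e = R′ i} {S = R} (λ y y-solves _ → R′-induced y y-solves i) R-induced)))

  nontrivial-independent : ∀ {k} {a : Equation k} → NontrivialEq a → IsSystem (asSystem a)
  nontrivial-independent (j , aⱼ≉0) λ′ combination≈0 zero =
    *-cancelʳ-≈0 aⱼ≉0 (trans (sym (+-identityʳ _)) (combination≈0 j))

  cOf-even : ∀ s → parity s ≡ 0ℙ → cOf s ≡ s
  cOf-even s even with parity s
  cOf-even s ≡.refl | 0ℙ = ≡.refl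

  cOf-odd : ∀ s → parity s ≡ 1ℙ → cOf s ≡ suc s
  cOf-odd s odd with parity s
  cOf-odd s ≡.refl | 1ℙ = ≡.refl

lemma2p4 : ∀ {c ℓ} (F : FiniteField c ℓ) → let open LinearForms F in
    ∀ (m k : ℕ) → 2 ≤ m → m ≤ k →
    (L : System m k) → IsSystem L →
    (s : ℕ) → IsS L s →
    (b : ℕ) (ι : Fin b → Fin k) → IsCritical L s ι →
    (mB : ℕ) → IsMB L ι mB →
    ((L₁ L₂ : System mB b) → IsSystem L₁ → Induces L ι L₁ →
       IsSystem L₂ → Induces L ι L₂ → Equivalent L₁ L₂)
    × (parity s ≡ 0ℙ → mB ≡ 1)
    × (parity s ≡ 1ℙ → mB ≡ 1 ⊎ mB ≡ 2)
lemma2p4 F m k _ _ L _ s s-is-s b ι (increasing , b≡cOf , _ , L′ , (i₀ , j₀ , L′≉0) , L′-induced)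
         mB ((R , R-independent , R-induced) , maximal) =
  uniqueness , mB≡1 , mB≡1∨2
  where
  open LinearForms F

  uniqueness : (L₁ L₂ : System mB b) → IsSystem L₁ → Induces L ι L₁ →
               IsSystem L₂ → Induces L ι L₂ → Equivalent L₁ L₂
  uniqueness L₁ L₂ L₁-independent L₁-induced L₂-independent L₂-induced =
    maximal-induces F maximal L₁ L₁-independent L₁-induced L₂ L₂-induced ,
    maximal-induces F maximal L₂ L₂-independent L₂-induced L₁ L₁-induced

  1≤mB : 1 ≤ mB
  1≤mB = maximal 1 (asSystem (L′ i₀)) (nontrivial-independent F (j₀ , L′≉0))
                   (λ x x-solves _ → L′-induced x x-solves i₀)

  mB≤ : ∀ d → b ≡ d ℕ.+ s → mB ≤ suc d
  mB≤ d b≡d+s = ℕₚ.+-cancelˡ-≤ s mB (suc d)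
    (≡.subst (s ℕ.+ mB ≤_) (≡.trans (≡.cong suc b≡d+s) (ℕₚ.+-comm (suc d) s))
      (s+rows≤1+size F s-is-s (strictlyIncreasing⇒injective F increasing)
                     R R-independent R-induced 1≤mB))

  mB≡1 : parity s ≡ 0ℙ → mB ≡ 1
  mB≡1 even = ℕₚ.≤-antisym (mB≤ 0 (≡.trans b≡cOf (cOf-even F s even))) 1≤mB

  mB≡1∨2 : parity s ≡ 1ℙ → mB ≡ 1 ⊎ mB ≡ 2
  mB≡1∨2 odd = Sum.map₁ (λ mB<2 → ℕₚ.≤-antisym (ℕₚ.≤-pred mB<2) 1≤mB)
                        (ℕₚ.m≤n⇒m<n∨m≡n (mB≤ 1 (≡.trans b≡cOf (cOf-odd F s odd))))
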